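{- Let $n>c\ge 4$ and $c\ge s\ge 3$ be integers. Then $\max\{f_s(n,c,2),\,f_s(n,c,\lfloor c/2\rfloor)\}<h_s(n,c)$.
   Context: For integers $n,c,k,s$, $f_s(n,c,k)=\binom{c+1-k}{s}+(n-c-1+k)\binom{k}{s-1}$ (this is the number of $s$-cliques in $K_k\vee(K_{c+1-2k}+\overline{K_{n-c-1+k}})$). With $\alpha=\lfloor (n-1)/(c-1)\rfloor$ and $p=n-1-\alpha(c-1)$, $h_s(n,c)=\alpha\binom{c}{s}+\binom{p+1}{s}$. -}

module Defs where

open import Data.Nat using (ℕ; _+_; _*_; _∸_; _/_)
open import Data.Nat.Combinatorics using (_C_)

-- f_s(n,c,k) = C(c+1-k, s) + (n-c-1+k) * C(k, s-1)
-- (all subtractions are non-negative in the range used by lemma8: k ≤ c, n > c, s ≥ 3)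
f : ℕ → ℕ → ℕ → ℕ → ℕ
f s n c k = ((c + 1) ∸ k) C s + ((n + k) ∸ (c + 1)) * (k C (s ∸ 1))

-- α = ⌊(n-1)/(c-1)⌋, p = n-1-α(c-1), h_s(n,c) = α C(c,s) + C(p+1,s)
-- (requires c ≥ 2 so that c ∸ 1 is nonzero)
α : (n c : ℕ) → ℕ
α n c = (n ∸ 1) / (1 + (c ∸ 2))

p : (n c : ℕ) → ℕ
p n c = (n ∸ 1) ∸ α n c * (c ∸ 1)

h : ℕ → ℕ → ℕ → ℕ
h s n c = α n c * (c C s) + (p n c + 1) C s

-- Write c = k + e and n − 1 = (a + 1)(c − 1) + p, so that n − c − 1 + k = a(c − 1) + (p + k − 1).
-- Each of the a blocks of c − 1 independent vertices contributes (c − 1)·C(k, s−1) ≤ C(c, s),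
-- the last p + k − 1 of them contribute at most C(p+1, s) + 2(k−1)·C(k, s−1), and
-- C(e+1, s) + 2(k−1)·C(k, s−1) < C(c, s) because k ≤ e.
-- Every estimate is a truncation of Vandermonde's convolution C(t + a, s) = Σᵢ C(t, i)·C(a, s − i).
module Submission where

open import Defs
open import Data.Nat
open import Data.Nat.Properties
open import Data.Nat.DivMod using (m/n*n≤m; m≥n⇒m/n>0; /-monoˡ-≤)
open import Data.Nat.Combinatorics using (_C_; nCk+nC[k+1]≡[n+1]C[k+1]; k>n⇒nCk≡0)
open import Data.Nat.Tactic.RingSolver using (solve-∀)
open import Data.Product using (_,_)
open import Data.Sum using (inj₁; inj₂)
open import Relation.Binary.PropositionalEquality

pascal : ∀ n k → suc n C suc k ≡ n C k + n C suc k
pascal n k = sym (nCk+nC[k+1]≡[n+1]C[k+1] n k)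

C-monoˡ-≤ : ∀ {m n} k → m ≤ n → m C k ≤ n C k
C-monoˡ-≤ k m≤n = go (≤⇒≤′ m≤n)
  where
  nCk≤[1+n]Ck : ∀ n k → n C k ≤ suc n C k
  nCk≤[1+n]Ck n zero    = ≤-refl
  nCk≤[1+n]Ck n (suc k) = ≤-trans (m≤n+m _ (n C k)) (≤-reflexive (sym (pascal n k)))
  go : ∀ {m n} → m ≤′ n → m C k ≤ n C k
  go ≤′-refl       = ≤-refl
  go (≤′-step m≤n) = ≤-trans (go m≤n) (nCk≤[1+n]Ck _ k)

k≤n⇒nCk>0 : ∀ {n k} → k ≤ n → 0 < n C k
k≤n⇒nCk>0 {n}     {zero}  _         = s≤s z≤n
k≤n⇒nCk>0 {suc n} {suc k} (s≤s k≤n) =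
  ≤-trans (k≤n⇒nCk>0 k≤n) (≤-trans (m≤m+n _ _) (≤-reflexive (sym (pascal n k))))

open ≤-Reasoning

vandermonde-≥₁ : ∀ t k r → t * (k C r) ≤ (t + k) C suc r
vandermonde-≥₁ zero    k r = z≤n
vandermonde-≥₁ (suc t) k r = begin
  k C r + t * (k C r)          ≤⟨ +-mono-≤ (C-monoˡ-≤ r (m≤n+m k t)) (vandermonde-≥₁ t k r) ⟩
  (t + k) C r + (t + k) C suc r ≡⟨ pascal (t + k) r ⟨
  suc (t + k) C suc r           ∎

vandermonde-≥₂ : ∀ a t q → a C suc q + t C suc q ≤ (a + t) C suc q
vandermonde-≥₂ zero    t q = ≤-refl
vandermonde-≥₂ (suc a) t q = begin
  suc a C suc q + t C suc q       ≡⟨ cong (_+ t C suc q) (pascal a q) ⟩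
  a C q + a C suc q + t C suc q   ≡⟨ +-assoc (a C q) _ _ ⟩
  a C q + (a C suc q + t C suc q) ≤⟨ +-mono-≤ (C-monoˡ-≤ q (m≤m+n a t)) (vandermonde-≥₂ a t q) ⟩
  (a + t) C q + (a + t) C suc q   ≡⟨ pascal (a + t) q ⟨
  suc (a + t) C suc q             ∎

vandermonde-≥₃ : ∀ a t q → a C (2 + q) + a * (t C (1 + q)) + t C (2 + q) ≤ (a + t) C (2 + q)
vandermonde-≥₃ zero    t q = ≤-refl
vandermonde-≥₃ (suc a) t q = begin
  suc a C (2 + q) + suc a * T₁ + T₂ ≡⟨ cong (λ x → x + suc a * T₁ + T₂) (pascal a (1 + q)) ⟩
  A₁ + A₂ + (T₁ + a * T₁) + T₂      ≡⟨ regroup A₁ A₂ T₁ a T₂ ⟩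
  (A₁ + T₁) + (A₂ + a * T₁ + T₂)    ≤⟨ +-mono-≤ (vandermonde-≥₂ a t q) (vandermonde-≥₃ a t q) ⟩
  (a + t) C (1 + q) + (a + t) C (2 + q) ≡⟨ pascal (a + t) (1 + q) ⟨
  suc (a + t) C (2 + q)             ∎
  where
  A₁ = a C (1 + q)
  A₂ = a C (2 + q)
  T₁ = t C (1 + q)
  T₂ = t C (2 + q)
  regroup : ∀ x y z u v → x + y + (z + u * z) + v ≡ (x + z) + (y + u * z + v)
  regroup = solve-∀

vandermonde-≥₄ : ∀ t a q →
  t C (3 + q) + t * (a C (2 + q)) + (t C (2 + q)) * a + a C (3 + q) ≤ (t + a) C (3 + q)
vandermonde-≥₄ zero    a q = ≤-refl
vandermonde-≥₄ (suc t) a q = begin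
  suc t C (3 + q) + suc t * A₂ + (suc t C (2 + q)) * a + A₃
    ≡⟨ cong₂ (λ x y → x + suc t * A₂ + y * a + A₃) (pascal t (2 + q)) (pascal t (1 + q)) ⟩
  (T₂ + T₃) + (A₂ + t * A₂) + (T₁ + T₂) * a + A₃
    ≡⟨ regroup T₂ T₃ A₂ t T₁ a A₃ ⟩
  (A₂ + a * T₁ + T₂) + (T₃ + t * A₂ + T₂ * a + A₃)
    ≤⟨ +-mono-≤ (≤-trans (vandermonde-≥₃ a t q) (≤-reflexive (cong (_C (2 + q)) (+-comm a t))))
                (vandermonde-≥₄ t a q) ⟩
  (t + a) C (2 + q) + (t + a) C (3 + q)
    ≡⟨ pascal (t + a) (2 + q) ⟨
  suc (t + a) C (3 + q) ∎
  where
  A₂ = a C (2 + q)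
  A₃ = a C (3 + q)
  T₁ = t C (1 + q)
  T₂ = t C (2 + q)
  T₃ = t C (3 + q)
  regroup : ∀ x₂ x₃ y t x₁ a y₃ →
    (x₂ + x₃) + (y + t * y) + (x₁ + x₂) * a + y₃ ≡ (y + a * x₁ + x₂) + (x₃ + t * y + x₂ * a + y₃)
  regroup = solve-∀

full-block-bound : ∀ {k e} s → 3 ≤ s → k ≤ e → (k + e) * (k C (s ∸ 1)) ≤ (k + e) C s
full-block-bound {k} {e} (suc (suc (suc q))) (s≤s (s≤s (s≤s _))) k≤e = begin
  (k + e) * Y                  ≡⟨ split k e Y ⟩
  k * Y + Y * e                ≤⟨ +-monoˡ-≤ (Y * e) (*-monoʳ-≤ k (C-monoˡ-≤ (2 + q) k≤e)) ⟩
  k * X + Y * e                ≤⟨ m≤n+m _ (k C (3 + q)) ⟩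
  k C (3 + q) + (k * X + Y * e) ≡⟨ +-assoc (k C (3 + q)) _ _ ⟨
  k C (3 + q) + k * X + Y * e  ≤⟨ m≤m+n _ (e C (3 + q)) ⟩
  k C (3 + q) + k * X + Y * e + e C (3 + q) ≤⟨ vandermonde-≥₄ k e q ⟩
  (k + e) C (3 + q)            ∎
  where
  X = e C (2 + q)
  Y = k C (2 + q)
  split : ∀ k e y → (k + e) * y ≡ k * y + y * e
  split = solve-∀

partial-block-bound : ∀ p k s → 1 ≤ k → 1 ≤ s →
  (p + (k ∸ 1)) * (k C (s ∸ 1)) ≤ suc p C s + 2 * (k ∸ 1) * (k C (s ∸ 1))
partial-block-bound p (suc i) (suc r) _ _ with ≤-<-connex (suc i) (suc p)
... | inj₁ k≤1+p with t , refl ← m≤n⇒∃[o]m+o≡n k≤1+p = begin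
  (i + t + i) * Y                   ≡⟨ regroup i t Y ⟩
  t * Y + 2 * i * Y                 ≤⟨ +-monoˡ-≤ (2 * i * Y) (vandermonde-≥₁ t (suc i) r) ⟩
  (t + suc i) C suc r + 2 * i * Y   ≡⟨ cong (λ x → x C suc r + 2 * i * Y) (+-comm t (suc i)) ⟩
  (suc i + t) C suc r + 2 * i * Y   ∎
  where
  Y = suc i C r
  regroup : ∀ i t y → (i + t + i) * y ≡ t * y + 2 * i * y
  regroup = solve-∀
... | inj₂ 1+p<k = ≤-trans (*-monoˡ-≤ (suc i C r) p+i≤2i) (m≤n+m _ (suc p C suc r))
  where
  p+i≤2i : p + i ≤ 2 * i
  p+i≤2i = ≤-trans (+-monoˡ-≤ i (<⇒≤ (≤-pred 1+p<k)))
                   (≤-reflexive (cong (i +_) (sym (+-identityʳ i))))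

base-bound : ∀ {k e} s → 2 ≤ k → k ≤ e → 3 ≤ s → s ≤ k + e →
  suc e C s + 2 * (k ∸ 1) * (k C (s ∸ 1)) < (k + e) C s
base-bound {k@(suc (suc j))} {e} s@(suc (suc (suc q))) (s≤s (s≤s _)) k≤e (s≤s (s≤s (s≤s _))) s≤k+e
  with ≤-<-connex (2 + q) e
... | inj₁ s∸1≤e = begin
  suc (suc e C s + 2 * suc j * Y)    ≡⟨ cong (λ x → suc (x + 2 * suc j * Y)) (pascal e (2 + q)) ⟩
  suc (X + E + 2 * suc j * Y)        ≡⟨ regroup₁ X E Y j ⟩
  X + E + k * Y + (1 + j * Y)
    ≤⟨ +-monoʳ-≤ (X + E + k * Y) (+-mono-≤ (k≤n⇒nCk>0 s∸1≤e) (*-monoʳ-≤ j Y≤X)) ⟩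
  X + E + k * Y + (X + j * X)        ≡⟨ regroup₂ X E Y j ⟩
  k * X + Y * k + E                  ≤⟨ +-monoˡ-≤ E (+-monoʳ-≤ (k * X) (*-monoʳ-≤ Y k≤e)) ⟩
  k * X + Y * e + E                  ≤⟨ +-monoˡ-≤ E (+-monoˡ-≤ (Y * e) (m≤n+m (k * X) (k C s))) ⟩
  k C s + k * X + Y * e + E          ≤⟨ vandermonde-≥₄ k e q ⟩
  (k + e) C s                        ∎
  where
  X = e C (2 + q)
  E = e C s
  Y = k C (2 + q)
  Y≤X : Y ≤ X
  Y≤X = C-monoˡ-≤ (2 + q) k≤e
  regroup₁ : ∀ x z y j → suc (x + z + 2 * suc j * y) ≡ x + z + (2 + j) * y + (1 + j * y)
  regroup₁ = solve-∀
  regroup₂ : ∀ x z y j → x + z + (2 + j) * y + (x + j * x) ≡ (2 + j) * x + y * (2 + j) + z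
  regroup₂ = solve-∀
... | inj₂ e<s∸1
  rewrite k>n⇒nCk≡0 (s≤s e<s∸1)
        | k>n⇒nCk≡0 (≤-<-trans k≤e e<s∸1)
        | *-zeroʳ (2 * suc j) = k≤n⇒nCk>0 s≤k+e

blocks-bound : ∀ {k e s} p a d → 2 ≤ k → k ≤ e → 3 ≤ s → s ≤ k + e → d ≤ k + e →
  suc e C s + (p + a * d + (k ∸ 1)) * (k C (s ∸ 1)) < suc a * ((k + e) C s) + suc p C s
blocks-bound {k} {e} {s} p a d 2≤k k≤e 3≤s s≤k+e d≤k+e = begin-strict
  E + (p + a * d + i) * Y            ≡⟨ regroup₁ E p a d i Y ⟩
  E + (p + i) * Y + a * (d * Y)
    ≤⟨ +-monoˡ-≤ (a * (d * Y)) (+-monoʳ-≤ E (partial-block-bound p k s 1≤k 1≤s)) ⟩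
  E + (P + 2 * i * Y) + a * (d * Y)  ≡⟨ regroup₂ E P (2 * i * Y) (a * (d * Y)) ⟩
  E + 2 * i * Y + a * (d * Y) + P
    <⟨ +-monoˡ-< P (+-mono-<-≤ (base-bound s 2≤k k≤e 3≤s s≤k+e) (*-monoʳ-≤ a dY≤B)) ⟩
  B + a * B + P                      ∎
  where
  i = k ∸ 1
  Y = k C (s ∸ 1)
  B = (k + e) C s
  E = suc e C s
  P = suc p C s
  1≤k : 1 ≤ k
  1≤k = ≤-trans (s≤s z≤n) 2≤k
  1≤s : 1 ≤ s
  1≤s = ≤-trans (s≤s z≤n) 3≤s
  dY≤B : d * Y ≤ B
  dY≤B = ≤-trans (*-monoˡ-≤ Y d≤k+e) (full-block-bound s 3≤s k≤e)
  regroup₁ : ∀ z p a d i y → z + (p + a * d + i) * y ≡ z + (p + i) * y + a * (d * y)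
  regroup₁ = solve-∀
  regroup₂ : ∀ z x y w → z + (x + y) + w ≡ z + y + w + x
  regroup₂ = solve-∀

f<h : ∀ {n c s} k → 2 ≤ k → k + k ≤ c → 3 ≤ s → s ≤ c → c < n → f s n c k < h s n c
f<h {suc m} {_} {s} k 2≤k@(s≤s (s≤s _)) 2k≤c 3≤s s≤c (s≤s c≤m)
  with e , refl ← m≤n⇒∃[o]m+o≡n (≤-trans (m≤m+n k k) 2k≤c)
  with a , 1+a≡α ← m≤n⇒∃[o]m+o≡n (m≥n⇒m/n>0 (≤-trans (n≤1+n (k + e ∸ 1)) c≤m))
  = subst₂ _<_ (sym f≡) (sym h≡)
      (blocks-bound r a d 2≤k (+-cancelˡ-≤ k k e 2k≤c) 3≤s s≤c (n≤1+n d))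
  where
  d = k + e ∸ 1
  r = p (suc m) (k + e)
  m≡r+[1+a]d : r + suc a * d ≡ m
  m≡r+[1+a]d = trans (cong (λ x → r + x * d) 1+a≡α) (m∸n+n≡m (m/n*n≤m m d))
  f≡ : f s (suc m) (k + e) k ≡ suc e C s + (r + a * d + (k ∸ 1)) * (k C (s ∸ 1))
  f≡ = cong₂ (λ x y → x C s + y * (k C (s ∸ 1))) top≡ rest≡
    where
    top≡ : k + e + 1 ∸ k ≡ suc e
    top≡ = trans (cong (_∸ k) (+-assoc k e 1)) (trans (m+n∸m≡n k (e + 1)) (+-comm e 1))
    regroup : ∀ r a j e →
      suc (r + suc a * suc (j + e)) + suc (suc j) ≡ r + a * suc (j + e) + suc j + (suc (suc (j + e)) + 1)
    regroup = solve-∀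
    rest≡ : suc m + k ∸ (k + e + 1) ≡ r + a * d + (k ∸ 1)
    rest≡ = begin-equality
      suc m + k ∸ (k + e + 1)                         ≡⟨ cong (λ x → suc x + k ∸ (k + e + 1)) m≡r+[1+a]d ⟨
      suc (r + suc a * d) + k ∸ (k + e + 1)           ≡⟨ cong (_∸ (k + e + 1)) (regroup r a (k ∸ 2) e) ⟩
      r + a * d + (k ∸ 1) + (k + e + 1) ∸ (k + e + 1) ≡⟨ m+n∸n≡m _ (k + e + 1) ⟩
      r + a * d + (k ∸ 1)                             ∎
  h≡ : h s (suc m) (k + e) ≡ suc a * ((k + e) C s) + suc r C s
  h≡ = cong₂ _+_ (cong (_* ((k + e) C s)) (sym 1+a≡α)) (cong (_C s) (+-comm r 1))

lemma8 : ∀ (n c s : ℕ) → c < n → 4 ≤ c → 3 ≤ s → s ≤ c →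
    f s n c 2 ⊔ f s n c (c / 2) < h s n c
lemma8 n c s c<n 4≤c 3≤s s≤c =
  ⊔-lub (f<h 2 ≤-refl 4≤c 3≤s s≤c c<n) (f<h (c / 2) 2≤c/2 c/2+c/2≤c 3≤s s≤c c<n)
  where
  2≤c/2 : 2 ≤ c / 2
  2≤c/2 = /-monoˡ-≤ 2 4≤c
  c/2+c/2≤c : c / 2 + c / 2 ≤ c
  c/2+c/2≤c = subst (_≤ c) (double (c / 2)) (m/n*n≤m c 2)
    where
    double : ∀ x → x * 2 ≡ x + x
    double = solve-∀
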